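{- Let $n\ge 7$, let $\mathcal{F}$ be an independent set of $\Gamma(n,1,n-3)$, and let $B_1\neq B_2$ be subsets of $[n]$ of size $n-3$ each having $\mathcal{F}$-weight $n-3$. Then: (a) if $A\subseteq[n]\setminus B_1$ with $|A|=1$, the $\mathcal{F}$-weight of $A$ is at most $\binom{n-1}{3}-\binom{n-3}{3}$; (b) if $|[n]\setminus(B_1\cup B_2)|=2$ and $A\subseteq[n]\setminus(B_1\cup B_2)$ with $|A|=1$, the $\mathcal{F}$-weight of $A$ is at most $\binom{n-1}{3}-2\binom{n-3}{3}+\binom{n-4}{3}$.
   Context: $[n]=\{1,\dots,n\}$. The graph $\Gamma(n,1,n-3)$ has as vertices the pairs (flags) $(A,B)$ with $A\subseteq B\subseteq[n]$, $|A|=1$, $|B|=n-3$; two vertices $(A_1,B_1),(A_2,B_2)$ are adjacent (opposite) iff $B_1\cup B_2=[n]$, $A_1\cap B_2=\emptyset$ and $A_2\cap B_1=\emptyset$. An independent set is a set of pairwise non-adjacent vertices. For an independent set $\mathcal{F}$, the $\mathcal{F}$-weight of an $(n-3)$-set $B$ is the number of flags in $\mathcal{F}$ with second component $B$, and the $\mathcal{F}$-weight of a $1$-set $A$ is the number of flags in $\mathcal{F}$ with first component $A$. -}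

module Defs where

open import Data.Nat using (ℕ; _∸_)
open import Data.Fin using (Fin)
open import Data.Fin.Properties as FinP using ()
open import Data.Fin.Subset using (Subset; _∈_; _∉_; _∪_; ⊤; ∣_∣)
open import Data.Bool.Properties as BoolP using ()
open import Data.Vec.Properties as VecP using ()
open import Data.Product using (_×_; _,_; proj₁; proj₂)
open import Data.List using (List; length; filter)
open import Data.List.Membership.Propositional using () renaming (_∈_ to _∈ₗ_)
open import Data.List.Relation.Unary.Unique.Propositional using (Unique)
open import Relation.Binary.PropositionalEquality using (_≡_)
open import Relation.Nullary using (¬_)
open import Relation.Nullary.Decidable using (does)
open import Relation.Unary using (Pred)
open import Data.Bool using (Bool)

-- A candidate vertex: a pair (a, B), encoding the flag ({a}, B).
Pair : ℕ → Set
Pair n = Fin n × Subset n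

IsFlag : ∀ {n} → Pair n → Set
IsFlag {n} (a , B) = (a ∈ B) × (∣ B ∣ ≡ n ∸ 3)

Opposite : ∀ {n} → Pair n → Pair n → Set
Opposite (a₁ , B₁) (a₂ , B₂) = ((B₁ ∪ B₂) ≡ ⊤) × (a₁ ∉ B₂) × (a₂ ∉ B₁)

record IndependentSet (n : ℕ) : Set where
  field
    elems    : List (Pair n)
    unique   : Unique elems
    flags    : ∀ {x} → x ∈ₗ elems → IsFlag x
    indep    : ∀ {x y} → x ∈ₗ elems → y ∈ₗ elems → ¬ Opposite x y
open IndependentSet public

weightB : ∀ {n} → IndependentSet n → Subset n → ℕ
weightB F B = length (filter (λ x → VecP.≡-dec BoolP._≟_ (proj₂ x) B) (elems F))

weightA : ∀ {n} → IndependentSet n → Fin n → ℕ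
weightA F a = length (filter (λ x → proj₁ x FinP.≟ a) (elems F))

-- If B₁ has F-weight |B₁| = n − 3, then every flag ({b}, B₁) with b ∈ B₁ lies in F. A flag ({a}, B) of F
-- with a ∉ B₁ and B ⊇ [n] ∖ B₁ would be opposite to ({b}, B₁) for any b ∈ B₁ ∖ B, which exists since
-- B ≠ [n]. So the second components of the flags of F with first component {a} are distinct (n − 3)-sets
-- containing a but not containing [n] ∖ B₁ (in (b), nor [n] ∖ B₂). There are C(n−1,3) such sets containing a,
-- C(|B₁|,3) of them contain the 3-set [n] ∖ B₁, and C(|B₁ ∩ B₂|,3) contain ([n] ∖ B₁) ∪ ([n] ∖ B₂);
-- in (b) this union has 4 elements, so inclusion–exclusion gives the bound with C(n−4,3).

module Submission where

open import Defs
open import Data.Nat using (ℕ; _≤_; _∸_; _+_; _*_)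
open import Data.Nat.Combinatorics using (_C_)
open import Data.Fin using (Fin)
open import Data.Fin.Subset using (Subset; _∉_; _∪_; ∁; ∣_∣)
open import Data.Product using (_×_)
open import Relation.Binary.PropositionalEquality using (_≡_; _≢_)

open import Level using (0ℓ)
open import Function using (_∘_)
open import Data.Bool using (true; false)
import Data.Bool.Properties as Bool
open import Data.Nat using (zero; suc; pred; z≤n; s≤s; _≟_)
open import Data.Nat.Properties
  using (+-suc; +-identityʳ; +-comm; +-cancelˡ-≡; m+n∸m≡n; n∸n≡0; m∸[m∸n]≡n; 1+n≰n; module ≤-Reasoning)
open import Data.Nat.Combinatorics using (nCk+nC[k+1]≡[n+1]C[k+1])
open import Data.Nat.Tactic.RingSolver using (solve-∀)
open import Data.Fin using (zero; suc)
import Data.Fin.Properties as Fin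
open import Data.Fin.Subset using (_∈_; _⊆_; _∩_; ⊤; ⁅_⁆; inside; outside)
open import Data.Fin.Subset.Properties
  using (_⊆?_; _∈?_; ⊆-refl; ⊆-trans; ⊆-antisym; ⊆⊤; drop-∷-⊆; in⊆in; out⊆; p⊆p∪q; q⊆p∪q; x∈p∪q⁻;
         x∉p⇒x∈∁p; x∈⁅y⁆⇒x≡y; ∣⊤∣≡n; ∣⁅x⁆∣≡1; ∣∁p∣≡n∸∣p∣; ∪-∩-booleanAlgebra)
import Algebra.Lattice.Properties.BooleanAlgebra as BooleanAlgebra
open import Data.Vec using ([]; _∷_; here; there)
import Data.Vec.Properties as Vec
open import Data.List using (List; []; _∷_; [_]; _++_; map; filter; length)
open import Data.List.Properties using (length-++; length-map; filter-++; filter-≐; filter-none)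
open import Data.List.Membership.Propositional using () renaming (_∈_ to _∈ₗ_)
open import Data.List.Relation.Binary.Subset.Propositional using () renaming (_⊆_ to _⊆ₗ_)
open import Data.List.Membership.Propositional.Properties
  using (∈-∃++; ∈-++⁻; ∈-++⁺ˡ; ∈-++⁺ʳ; ∈-map⁺; ∈-filter⁺; ∈-filter⁻)
import Data.List.Membership.DecPropositional as DecMembership
open import Data.List.Relation.Unary.Any using (here; there)
import Data.List.Relation.Unary.All as All
open import Data.List.Relation.Unary.All.Properties using (¬Any⇒All¬)
open import Data.List.Relation.Unary.AllPairs using (_∷_)
open import Data.List.Relation.Unary.Unique.Propositional using (Unique)
import Data.List.Relation.Unary.Unique.Propositional.Properties as Unique
open import Data.Product using (_,_; proj₁; proj₂)
import Data.Product.Properties as Product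
open import Data.Sum using (inj₁; inj₂)
open import Relation.Binary.PropositionalEquality using (refl; sym; trans; cong; cong₂; subst; module ≡-Reasoning)
open import Relation.Nullary using (¬_; yes; no; does; contradiction)
open import Relation.Nullary.Decidable using (_×-dec_; ¬?; decidable-stable)
open import Relation.Unary using (Pred; Decidable; _≐_)
open import Relation.Unary.Properties using (_∩?_; ∁?; ∅?)

count : ∀ {a p} {A : Set a} {P : Pred A p} → Decidable P → List A → ℕ
count P? xs = length (filter P? xs)

module _ {a} {A : Set a} where

  Unique⇒⊆⇒length≤ : {xs ys : List A} → Unique xs → xs ⊆ₗ ys → length xs ≤ length ys
  Unique⇒⊆⇒length≤ {[]} _ _ = z≤n
  Unique⇒⊆⇒length≤ {x ∷ xs} (x∉xs ∷ xs!) xs⊆ys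
    with us , vs , refl ← ∈-∃++ (xs⊆ys (here refl)) = begin
      suc (length xs)              ≤⟨ s≤s (Unique⇒⊆⇒length≤ xs! xs⊆us++vs) ⟩
      suc (length (us ++ vs))      ≡⟨ cong suc (length-++ us) ⟩
      suc (length us + length vs)  ≡⟨ +-suc (length us) (length vs) ⟨
      length us + length (x ∷ vs)  ≡⟨ length-++ us ⟨
      length (us ++ x ∷ vs)        ∎
    where
    open ≤-Reasoning
    xs⊆us++vs : xs ⊆ₗ us ++ vs
    xs⊆us++vs z∈xs with ∈-++⁻ us (xs⊆ys (there z∈xs))
    ... | inj₁ z∈us          = ∈-++⁺ˡ z∈us
    ... | inj₂ (here refl)   = contradiction refl (All.lookup x∉xs z∈xs)
    ... | inj₂ (there z∈vs)  = ∈-++⁺ʳ us z∈vs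

  module _ {p q} {P : Pred A p} {Q : Pred A q} (P? : Decidable P) (Q? : Decidable Q) where

    count-∩∁ : ∀ xs → count P? xs ≡ count (P? ∩? Q?) xs + count (P? ∩? ∁? Q?) xs
    count-∩∁ [] = refl
    count-∩∁ (x ∷ xs) with does (P? x) | does (Q? x)
    ... | true  | true  = cong suc (count-∩∁ xs)
    ... | true  | false = trans (cong suc (count-∩∁ xs)) (sym (+-suc _ _))
    ... | false | _     = count-∩∁ xs

    count-∩∁-∸ : ∀ xs → count (P? ∩? ∁? Q?) xs ≡ count P? xs ∸ count (P? ∩? Q?) xs
    count-∩∁-∸ xs =
      trans (sym (m+n∸m≡n (count (P? ∩? Q?) xs) _)) (cong (_∸ count (P? ∩? Q?) xs) (sym (count-∩∁ xs)))

    count-≐ : P ≐ Q → ∀ xs → count P? xs ≡ count Q? xs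
    count-≐ P≐Q xs = cong length (filter-≐ P? Q? P≐Q xs)

  module _ {p} {P : Pred A p} (P? : Decidable P) where

    count-++ : ∀ xs ys → count P? (xs ++ ys) ≡ count P? xs + count P? ys
    count-++ xs ys = trans (cong length (filter-++ P? xs ys)) (length-++ (filter P? xs))

    count-map : ∀ {b} {B : Set b} (f : B → A) xs → count P? (map f xs) ≡ count {P = P ∘ f} (P? ∘ f) xs
    count-map f [] = refl
    count-map f (x ∷ xs) with does (P? (f x))
    ... | true  = cong suc (count-map f xs)
    ... | false = count-map f xs

    count-none : (∀ x → ¬ P x) → ∀ xs → count P? xs ≡ 0
    count-none ¬P xs = cong length (filter-none P? (All.universal ¬P xs))

  count-inclusion-exclusion :
    ∀ {p q r} {P : Pred A p} {Q : Pred A q} {R : Pred A r}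
    (P? : Decidable P) (Q? : Decidable Q) (R? : Decidable R) xs →
    count ((P? ∩? ∁? Q?) ∩? ∁? R?) xs ≡
    (count P? xs + count ((P? ∩? Q?) ∩? R?) xs) ∸ (count (P? ∩? Q?) xs + count (P? ∩? R?) xs)
  count-inclusion-exclusion P? Q? R? xs =
    trans (sym (m+n∸m≡n (PQ + PR) PQ'R')) (cong (_∸ (PQ + PR)) counts)
    where
    open ≡-Reasoning
    PQ PR PQR PQ'R PQ'R' : ℕ
    PQ    = count (P? ∩? Q?) xs
    PR    = count (P? ∩? R?) xs
    PQR   = count ((P? ∩? Q?) ∩? R?) xs
    PQ'R  = count ((P? ∩? ∁? Q?) ∩? R?) xs
    PQ'R' = count ((P? ∩? ∁? Q?) ∩? ∁? R?) xs
    swap : ∀ {a b c} {X : Set a} {Y : Set b} {Z : Set c} → (X × Y) × Z → (X × Z) × Y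
    swap ((x , y) , z) = (x , z) , y
    count-P : count P? xs ≡ PQ + (PQ'R + PQ'R')
    count-P = trans (count-∩∁ P? Q? xs) (cong (PQ +_) (count-∩∁ (P? ∩? ∁? Q?) R? xs))
    count-PR : PR ≡ PQR + PQ'R
    count-PR = trans (count-∩∁ (P? ∩? R?) Q? xs)
                     (cong₂ _+_ (count-≐ _ _ (swap , swap) xs) (count-≐ _ _ (swap , swap) xs))
    shuffle : ∀ a b c d → a + (b + c) + d ≡ a + (c + d) + b
    shuffle = solve-∀
    counts : PQ + PR + PQ'R' ≡ count P? xs + PQR
    counts = begin
      PQ + PR + PQ'R'            ≡⟨ cong (λ k → PQ + k + PQ'R') count-PR ⟩
      PQ + (PQR + PQ'R) + PQ'R'  ≡⟨ shuffle PQ PQR PQ'R PQ'R' ⟩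
      PQ + (PQ'R + PQ'R') + PQR  ≡⟨ cong (_+ PQR) count-P ⟨
      count P? xs + PQR          ∎

module _ {n : ℕ} where

  private module BA = BooleanAlgebra (∪-∩-booleanAlgebra n)

  ∁-involutive : (p : Subset n) → ∁ (∁ p) ≡ p
  ∁-involutive = BA.¬-involutive

  ∁-∪ : (p q : Subset n) → ∁ (p ∪ q) ≡ ∁ p ∩ ∁ q
  ∁-∪ = BA.deMorgan₂

  x∈p⇒⁅x⁆⊆p : ∀ {x} {p : Subset n} → x ∈ p → ⁅ x ⁆ ⊆ p
  x∈p⇒⁅x⁆⊆p {x} {p} x∈p y∈⁅x⁆ = subst (_∈ p) (sym (x∈⁅y⁆⇒x≡y x y∈⁅x⁆)) x∈p

  ∪-lub : ∀ {p q r : Subset n} → p ⊆ r → q ⊆ r → p ∪ q ⊆ r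
  ∪-lub {p} {q} p⊆r q⊆r x∈p∪q with x∈p∪q⁻ p q x∈p∪q
  ... | inj₁ x∈p = p⊆r x∈p
  ... | inj₂ x∈q = q⊆r x∈q

  ∁p⊆q⇒q∪p≡⊤ : ∀ {p q : Subset n} → ∁ p ⊆ q → q ∪ p ≡ ⊤
  ∁p⊆q⇒q∪p≡⊤ {p} {q} ∁p⊆q = ⊆-antisym ⊆⊤ ⊤⊆q∪p
    where
    ⊤⊆q∪p : ⊤ ⊆ q ∪ p
    ⊤⊆q∪p {x} _ with x ∈? p
    ... | yes x∈p = q⊆p∪q q p x∈p
    ... | no  x∉p = p⊆p∪q p (∁p⊆q (x∉p⇒x∈∁p x∉p))

∣p∪q∣+∣p∩q∣≡∣p∣+∣q∣ : ∀ {n} (p q : Subset n) → ∣ p ∪ q ∣ + ∣ p ∩ q ∣ ≡ ∣ p ∣ + ∣ q ∣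
∣p∪q∣+∣p∩q∣≡∣p∣+∣q∣ [] [] = refl
∣p∪q∣+∣p∩q∣≡∣p∣+∣q∣ (inside ∷ p) (inside ∷ q) =
  cong suc (trans (+-suc _ _) (trans (cong suc (∣p∪q∣+∣p∩q∣≡∣p∣+∣q∣ p q)) (sym (+-suc _ _))))
∣p∪q∣+∣p∩q∣≡∣p∣+∣q∣ (inside ∷ p) (outside ∷ q) = cong suc (∣p∪q∣+∣p∩q∣≡∣p∣+∣q∣ p q)
∣p∪q∣+∣p∩q∣≡∣p∣+∣q∣ (outside ∷ p) (inside ∷ q) =
  trans (cong suc (∣p∪q∣+∣p∩q∣≡∣p∣+∣q∣ p q)) (sym (+-suc ∣ p ∣ ∣ q ∣))
∣p∪q∣+∣p∩q∣≡∣p∣+∣q∣ (outside ∷ p) (outside ∷ q) = ∣p∪q∣+∣p∩q∣≡∣p∣+∣q∣ p q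

elements : ∀ {n} → Subset n → List (Fin n)
elements []            = []
elements (inside ∷ p)  = zero ∷ map suc (elements p)
elements (outside ∷ p) = map suc (elements p)

length-elements : ∀ {n} (p : Subset n) → length (elements p) ≡ ∣ p ∣
length-elements []            = refl
length-elements (inside ∷ p)  = cong suc (trans (length-map suc (elements p)) (length-elements p))
length-elements (outside ∷ p) = trans (length-map suc (elements p)) (length-elements p)

∈-elements : ∀ {n x} {p : Subset n} → x ∈ p → x ∈ₗ elements p
∈-elements {p = inside ∷ p}  here        = here refl
∈-elements {p = inside ∷ p}  (there x∈p) = there (∈-map⁺ suc (∈-elements x∈p))
∈-elements {p = outside ∷ p} (there x∈p) = ∈-map⁺ suc (∈-elements x∈p)

subsets : ∀ n → List (Subset n)
subsets zero    = [ [] ]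
subsets (suc n) = map (inside ∷_) (subsets n) ++ map (outside ∷_) (subsets n)

∈-subsets : ∀ {n} (p : Subset n) → p ∈ₗ subsets n
∈-subsets []            = here refl
∈-subsets (inside ∷ p)  = ∈-++⁺ˡ (∈-map⁺ (inside ∷_) (∈-subsets p))
∈-subsets (outside ∷ p) = ∈-++⁺ʳ (map (inside ∷_) (subsets _)) (∈-map⁺ (outside ∷_) (∈-subsets p))

count-subsets-∷ : ∀ {n p q r} {P : Pred (Subset (suc n)) p} {Q : Pred (Subset n) q} {R : Pred (Subset n) r}
  (P? : Decidable P) (Q? : Decidable Q) (R? : Decidable R) →
  (P ∘ (inside ∷_)) ≐ Q → (P ∘ (outside ∷_)) ≐ R →
  count P? (subsets (suc n)) ≡ count Q? (subsets n) + count R? (subsets n)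
count-subsets-∷ {n} P? Q? R? P₁≐Q P₀≐R = begin
  count P? (subsets (suc n))
    ≡⟨ count-++ P? (map (inside ∷_) (subsets n)) _ ⟩
  count P? (map (inside ∷_) (subsets n)) + count P? (map (outside ∷_) (subsets n))
    ≡⟨ cong₂ _+_ (count-map P? (inside ∷_) (subsets n)) (count-map P? (outside ∷_) (subsets n)) ⟩
  count (P? ∘ (inside ∷_)) (subsets n) + count (P? ∘ (outside ∷_)) (subsets n)
    ≡⟨ cong₂ _+_ (count-≐ (P? ∘ (inside ∷_)) Q? P₁≐Q (subsets n))
                 (count-≐ (P? ∘ (outside ∷_)) R? P₀≐R (subsets n)) ⟩
  count Q? (subsets n) + count R? (subsets n) ∎
  where open ≡-Reasoning

-- Sizes are measured by the complement, which keeps truncated subtraction out of the counting formula.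
SupersetOfCosize : ∀ {n} → Subset n → ℕ → Pred (Subset n) 0ℓ
SupersetOfCosize t c p = t ⊆ p × ∣ ∁ p ∣ ≡ c

supersetOfCosize? : ∀ {n} (t : Subset n) c → Decidable (SupersetOfCosize t c)
supersetOfCosize? t c p = t ⊆? p ×-dec ∣ ∁ p ∣ ≟ c

count-supersetsOfCosize : ∀ {n} (t : Subset n) c →
  count (supersetOfCosize? t c) (subsets n) ≡ ∣ ∁ t ∣ C c
count-supersetsOfCosize [] zero    = refl
count-supersetsOfCosize [] (suc c) = refl
count-supersetsOfCosize {suc n} (inside ∷ t) c = begin
  count (supersetOfCosize? (inside ∷ t) c) (subsets (suc n))
    ≡⟨ count-subsets-∷ _ (supersetOfCosize? t c) ∅?
         ((λ (t⊆p , e) → drop-∷-⊆ t⊆p , e) , (λ (t⊆p , e) → in⊆in t⊆p , e))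
         ((λ (t⊆p , _) → contradiction (t⊆p here) λ ()) , λ ()) ⟩
  count (supersetOfCosize? t c) (subsets n) + count ∅? (subsets n)
    ≡⟨ cong₂ _+_ (count-supersetsOfCosize t c) (count-none ∅? (λ _ ()) (subsets n)) ⟩
  ∣ ∁ t ∣ C c + 0
    ≡⟨ +-identityʳ _ ⟩
  ∣ ∁ t ∣ C c ∎
  where open ≡-Reasoning
count-supersetsOfCosize {suc n} (outside ∷ t) zero = begin
  count (supersetOfCosize? (outside ∷ t) zero) (subsets (suc n))
    ≡⟨ count-subsets-∷ _ (supersetOfCosize? t zero) ∅?
         ((λ (t⊆p , e) → drop-∷-⊆ t⊆p , e) , (λ (t⊆p , e) → out⊆ t⊆p , e))
         ((λ { (_ , ()) }) , λ ()) ⟩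
  count (supersetOfCosize? t zero) (subsets n) + count ∅? (subsets n)
    ≡⟨ cong₂ _+_ (count-supersetsOfCosize t zero) (count-none ∅? (λ _ ()) (subsets n)) ⟩
  1 ∎
  where open ≡-Reasoning
count-supersetsOfCosize {suc n} (outside ∷ t) (suc c) = begin
  count (supersetOfCosize? (outside ∷ t) (suc c)) (subsets (suc n))
    ≡⟨ count-subsets-∷ _ (supersetOfCosize? t (suc c)) (supersetOfCosize? t c)
         ((λ (t⊆p , e) → drop-∷-⊆ t⊆p , e) , (λ (t⊆p , e) → out⊆ t⊆p , e))
         ((λ (t⊆p , e) → drop-∷-⊆ t⊆p , cong pred e) , (λ (t⊆p , e) → out⊆ t⊆p , cong suc e)) ⟩
  count (supersetOfCosize? t (suc c)) (subsets n) + count (supersetOfCosize? t c) (subsets n)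
    ≡⟨ cong₂ _+_ (count-supersetsOfCosize t (suc c)) (count-supersetsOfCosize t c) ⟩
  ∣ ∁ t ∣ C suc c + ∣ ∁ t ∣ C c
    ≡⟨ +-comm (∣ ∁ t ∣ C suc c) _ ⟩
  ∣ ∁ t ∣ C c + ∣ ∁ t ∣ C suc c
    ≡⟨ nCk+nC[k+1]≡[n+1]C[k+1] ∣ ∁ t ∣ c ⟩
  suc ∣ ∁ t ∣ C suc c ∎
  where open ≡-Reasoning

-- For |B| = n − 3 this is the hypothesis "B has F-weight n − 3".
Saturated : ∀ {n} → IndependentSet n → Subset n → Set
Saturated F B = weightB F B ≡ ∣ B ∣

module _ {n : ℕ} (F : IndependentSet n) where

  private
    on? : (B : Subset n) → Decidable (λ (x : Pair n) → proj₂ x ≡ B)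
    on? B x = Vec.≡-dec Bool._≟_ (proj₂ x) B

    at? : (a : Fin n) → Decidable (λ (x : Pair n) → proj₁ x ≡ a)
    at? a x = proj₁ x Fin.≟ a

    flagsOn : Subset n → List (Pair n)
    flagsOn B = filter (on? B) (elems F)

    flagsAt : Fin n → List (Pair n)
    flagsAt a = filter (at? a) (elems F)

    open DecMembership (Product.≡-dec (Fin._≟_ {n}) (Vec.≡-dec {n = n} Bool._≟_)) using () renaming (_∈?_ to _∈ₗ?_)

  -- The first components of the flags on B are distinct elements of B, so a saturated B carries all of them.
  Saturated⇒flag∈ : ∀ {B b} → Saturated F B → b ∈ B → (b , B) ∈ₗ elems F
  Saturated⇒flag∈ {B} {b} sat b∈B with (b , B) ∈ₗ? flagsOn B
  ... | yes bB∈ = proj₁ (∈-filter⁻ (on? B) bB∈)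
  ... | no  bB∉ = contradiction too-long 1+n≰n
    where
    open ≤-Reasoning
    ⊆flags : (b , B) ∷ flagsOn B ⊆ₗ map (_, B) (elements B)
    ⊆flags (here refl) = ∈-map⁺ (_, B) (∈-elements b∈B)
    ⊆flags (there x∈) with ∈-filter⁻ (on? B) {xs = elems F} x∈
    ... | x∈F , refl = ∈-map⁺ (_, B) (∈-elements (proj₁ (flags F x∈F)))
    too-long : suc ∣ B ∣ ≤ ∣ B ∣
    too-long = begin
      suc ∣ B ∣                         ≡⟨ cong suc sat ⟨
      length ((b , B) ∷ flagsOn B)      ≤⟨ Unique⇒⊆⇒length≤ (¬Any⇒All¬ _ bB∉ ∷ Unique.filter⁺ _ (unique F)) ⊆flags ⟩
      length (map (_, B) (elements B))  ≡⟨ length-map _ (elements B) ⟩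
      length (elements B)               ≡⟨ length-elements B ⟩
      ∣ B ∣                             ∎

  weightA≤count : ∀ {a p} {P : Pred (Subset n) p} (P? : Decidable P) →
    (∀ {B} → (a , B) ∈ₗ elems F → P B) → weightA F a ≤ count P? (subsets n)
  weightA≤count {a} P? flag⇒P = begin
    length (flagsAt a)                          ≤⟨ Unique⇒⊆⇒length≤ (Unique.filter⁺ _ (unique F)) ⊆flags ⟩
    length (map (a ,_) (filter P? (subsets n))) ≡⟨ length-map _ (filter P? (subsets n)) ⟩
    count P? (subsets n)                        ∎
    where
    open ≤-Reasoning
    ⊆flags : flagsAt a ⊆ₗ map (a ,_) (filter P? (subsets n))
    ⊆flags x∈ with ∈-filter⁻ (at? a) {xs = elems F} x∈
    ... | x∈F , refl = ∈-map⁺ (a ,_) (∈-filter⁺ P? (∈-subsets _) (flag⇒P x∈F))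

  -- Otherwise (a , B) would be opposite to (b , B₁) for any b ∈ B₁ ∖ B, and B₁ ⊆ B would force B = ⊤.
  Saturated⇒∁⊈ : ∀ {a B₁ B} → Saturated F B₁ → a ∉ B₁ → (a , B) ∈ₗ elems F → B ≢ ⊤ → ¬ (∁ B₁ ⊆ B)
  Saturated⇒∁⊈ {a} {B₁} {B} sat a∉B₁ aB∈F B≢⊤ ∁B₁⊆B
    with Fin.any? (λ b → b ∈? B₁ ×-dec ¬? (b ∈? B))
  ... | yes (b , b∈B₁ , b∉B) =
    indep F aB∈F (Saturated⇒flag∈ sat b∈B₁) (∁p⊆q⇒q∪p≡⊤ ∁B₁⊆B , a∉B₁ , b∉B)
  ... | no ∄b = B≢⊤ (⊆-antisym ⊆⊤ (subst (_⊆ B) (∁p⊆q⇒q∪p≡⊤ ∁B₁⊆B) (∪-lub ⊆-refl B₁⊆B)))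
    where
    B₁⊆B : B₁ ⊆ B
    B₁⊆B {b} b∈B₁ = decidable-stable (b ∈? B) (λ b∉B → ∄b (b , b∈B₁ , b∉B))

module _ {n : ℕ} {a : Fin n} (c : ℕ) where

  private
    ⊇⁅a⁆? : Decidable (SupersetOfCosize ⁅ a ⁆ c)
    ⊇⁅a⁆? = supersetOfCosize? ⁅ a ⁆ c

    ⊇∁? : (B : Subset n) → Decidable (∁ B ⊆_)
    ⊇∁? B = ∁ B ⊆?_

    ⁅a⁆⊆∁ : ∀ {B} → a ∉ B → ⁅ a ⁆ ⊆ ∁ B
    ⁅a⁆⊆∁ a∉B = x∈p⇒⁅x⁆⊆p (x∉p⇒x∈∁p a∉B)

  count-⊇⁅a⁆ : count ⊇⁅a⁆? (subsets n) ≡ (n ∸ 1) C c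
  count-⊇⁅a⁆ = trans (count-supersetsOfCosize ⁅ a ⁆ c)
    (cong (_C c) (trans (∣∁p∣≡n∸∣p∣ ⁅ a ⁆) (cong (n ∸_) (∣⁅x⁆∣≡1 a))))

  count-⊇⁅a⁆-⊇∁ : ∀ {B₁} → a ∉ B₁ → count (⊇⁅a⁆? ∩? ⊇∁? B₁) (subsets n) ≡ ∣ B₁ ∣ C c
  count-⊇⁅a⁆-⊇∁ {B₁} a∉B₁ = begin
    count (⊇⁅a⁆? ∩? ⊇∁? B₁) (subsets n)
      ≡⟨ count-≐ _ (supersetOfCosize? (∁ B₁) c) (to , from) (subsets n) ⟩
    count (supersetOfCosize? (∁ B₁) c) (subsets n)
      ≡⟨ count-supersetsOfCosize (∁ B₁) c ⟩
    ∣ ∁ (∁ B₁) ∣ C c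
      ≡⟨ cong (λ p → ∣ p ∣ C c) (∁-involutive B₁) ⟩
    ∣ B₁ ∣ C c ∎
    where
    open ≡-Reasoning
    to : ∀ {B} → SupersetOfCosize ⁅ a ⁆ c B × ∁ B₁ ⊆ B → SupersetOfCosize (∁ B₁) c B
    to ((_ , e) , ∁B₁⊆B) = ∁B₁⊆B , e
    from : ∀ {B} → SupersetOfCosize (∁ B₁) c B → SupersetOfCosize ⁅ a ⁆ c B × ∁ B₁ ⊆ B
    from (∁B₁⊆B , e) = (⊆-trans (⁅a⁆⊆∁ a∉B₁) ∁B₁⊆B , e) , ∁B₁⊆B

  count-⊇⁅a⁆-⊇∁-⊇∁ : ∀ {B₁ B₂} → a ∉ B₁ →
    count ((⊇⁅a⁆? ∩? ⊇∁? B₁) ∩? ⊇∁? B₂) (subsets n) ≡ ∣ B₁ ∩ B₂ ∣ C c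
  count-⊇⁅a⁆-⊇∁-⊇∁ {B₁} {B₂} a∉B₁ = begin
    count ((⊇⁅a⁆? ∩? ⊇∁? B₁) ∩? ⊇∁? B₂) (subsets n)
      ≡⟨ count-≐ _ (supersetOfCosize? (∁ B₁ ∪ ∁ B₂) c) (to , from) (subsets n) ⟩
    count (supersetOfCosize? (∁ B₁ ∪ ∁ B₂) c) (subsets n)
      ≡⟨ count-supersetsOfCosize (∁ B₁ ∪ ∁ B₂) c ⟩
    ∣ ∁ (∁ B₁ ∪ ∁ B₂) ∣ C c
      ≡⟨ cong (λ p → ∣ p ∣ C c) (∁-∪ (∁ B₁) (∁ B₂)) ⟩
    ∣ ∁ (∁ B₁) ∩ ∁ (∁ B₂) ∣ C c
      ≡⟨ cong₂ (λ p q → ∣ p ∩ q ∣ C c) (∁-involutive B₁) (∁-involutive B₂) ⟩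
    ∣ B₁ ∩ B₂ ∣ C c ∎
    where
    open ≡-Reasoning
    to : ∀ {B} → (SupersetOfCosize ⁅ a ⁆ c B × ∁ B₁ ⊆ B) × ∁ B₂ ⊆ B →
         SupersetOfCosize (∁ B₁ ∪ ∁ B₂) c B
    to (((_ , e) , ∁B₁⊆B) , ∁B₂⊆B) = ∪-lub ∁B₁⊆B ∁B₂⊆B , e
    from : ∀ {B} → SupersetOfCosize (∁ B₁ ∪ ∁ B₂) c B →
           (SupersetOfCosize ⁅ a ⁆ c B × ∁ B₁ ⊆ B) × ∁ B₂ ⊆ B
    from (∁B₁∪∁B₂⊆B , e) = ((⊆-trans (⁅a⁆⊆∁ a∉B₁) ∁B₁⊆B , e) , ∁B₁⊆B) , ∁B₂⊆B
      where
      ∁B₁⊆B = ⊆-trans (p⊆p∪q (∁ B₂)) ∁B₁∪∁B₂⊆B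
      ∁B₂⊆B = ⊆-trans (q⊆p∪q (∁ B₁) (∁ B₂)) ∁B₁∪∁B₂⊆B

module _ {n : ℕ} (F : IndependentSet n) (3≤n : 3 ≤ n) {a : Fin n} where

  private
    ⊇⁅a⁆? : Decidable (SupersetOfCosize ⁅ a ⁆ 3)
    ⊇⁅a⁆? = supersetOfCosize? ⁅ a ⁆ 3

    ⊇∁? : (B : Subset n) → Decidable (∁ B ⊆_)
    ⊇∁? B = ∁ B ⊆?_

  flag-cosize : ∀ {x B} → IsFlag {n} (x , B) → ∣ ∁ B ∣ ≡ 3
  flag-cosize {B = B} (_ , ∣B∣≡) = trans (∣∁p∣≡n∸∣p∣ B) (trans (cong (n ∸_) ∣B∣≡) (m∸[m∸n]≡n 3≤n))

  flag≢⊤ : ∀ {x B} → IsFlag {n} (x , B) → B ≢ ⊤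
  flag≢⊤ flag refl = contradiction 0≡3 λ ()
    where
    0≡3 : 0 ≡ 3
    0≡3 = begin
      0                 ≡⟨ n∸n≡0 n ⟨
      n ∸ n             ≡⟨ cong (n ∸_) (∣⊤∣≡n n) ⟨
      n ∸ ∣ ⊤ {n} ∣     ≡⟨ ∣∁p∣≡n∸∣p∣ (⊤ {n}) ⟨
      ∣ ∁ (⊤ {n}) ∣     ≡⟨ flag-cosize flag ⟩
      3                 ∎
      where open ≡-Reasoning

  flag-⊇⁅a⁆ : ∀ {B} → (a , B) ∈ₗ elems F → SupersetOfCosize ⁅ a ⁆ 3 B
  flag-⊇⁅a⁆ aB∈F = x∈p⇒⁅x⁆⊆p (proj₁ (flags F aB∈F)) , flag-cosize (flags F aB∈F)

  flag-⊉∁ : ∀ {B₁ B} → Saturated F B₁ → a ∉ B₁ → (a , B) ∈ₗ elems F → ¬ (∁ B₁ ⊆ B)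
  flag-⊉∁ sat a∉B₁ aB∈F = Saturated⇒∁⊈ F sat a∉B₁ aB∈F (flag≢⊤ (flags F aB∈F))

  weightA-outside-saturated : ∀ {B₁} → Saturated F B₁ → a ∉ B₁ →
    weightA F a ≤ (n ∸ 1) C 3 ∸ ∣ B₁ ∣ C 3
  weightA-outside-saturated {B₁} sat a∉B₁ = begin
    weightA F a
      ≤⟨ weightA≤count F (⊇⁅a⁆? ∩? ∁? (⊇∁? B₁)) (λ aB∈F → flag-⊇⁅a⁆ aB∈F , flag-⊉∁ sat a∉B₁ aB∈F) ⟩
    count (⊇⁅a⁆? ∩? ∁? (⊇∁? B₁)) (subsets n)
      ≡⟨ count-∩∁-∸ ⊇⁅a⁆? (⊇∁? B₁) (subsets n) ⟩
    count ⊇⁅a⁆? (subsets n) ∸ count (⊇⁅a⁆? ∩? ⊇∁? B₁) (subsets n)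
      ≡⟨ cong₂ _∸_ (count-⊇⁅a⁆ {a = a} 3) (count-⊇⁅a⁆-⊇∁ 3 a∉B₁) ⟩
    (n ∸ 1) C 3 ∸ ∣ B₁ ∣ C 3 ∎
    where open ≤-Reasoning

  weightA-outside-two-saturated : ∀ {B₁ B₂} → Saturated F B₁ → Saturated F B₂ → a ∉ B₁ → a ∉ B₂ →
    weightA F a ≤ ((n ∸ 1) C 3 + ∣ B₁ ∩ B₂ ∣ C 3) ∸ (∣ B₁ ∣ C 3 + ∣ B₂ ∣ C 3)
  weightA-outside-two-saturated {B₁} {B₂} sat₁ sat₂ a∉B₁ a∉B₂ = begin
    weightA F a
      ≤⟨ weightA≤count F ((⊇⁅a⁆? ∩? ∁? (⊇∁? B₁)) ∩? ∁? (⊇∁? B₂))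
           (λ aB∈F → (flag-⊇⁅a⁆ aB∈F , flag-⊉∁ sat₁ a∉B₁ aB∈F) , flag-⊉∁ sat₂ a∉B₂ aB∈F) ⟩
    count ((⊇⁅a⁆? ∩? ∁? (⊇∁? B₁)) ∩? ∁? (⊇∁? B₂)) (subsets n)
      ≡⟨ count-inclusion-exclusion ⊇⁅a⁆? (⊇∁? B₁) (⊇∁? B₂) (subsets n) ⟩
    (count ⊇⁅a⁆? (subsets n) + count ((⊇⁅a⁆? ∩? ⊇∁? B₁) ∩? ⊇∁? B₂) (subsets n))
      ∸ (count (⊇⁅a⁆? ∩? ⊇∁? B₁) (subsets n) + count (⊇⁅a⁆? ∩? ⊇∁? B₂) (subsets n))
      ≡⟨ cong₂ _∸_ (cong₂ _+_ (count-⊇⁅a⁆ {a = a} 3) (count-⊇⁅a⁆-⊇∁-⊇∁ 3 a∉B₁))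
                   (cong₂ _+_ (count-⊇⁅a⁆-⊇∁ 3 a∉B₁) (count-⊇⁅a⁆-⊇∁ 3 a∉B₂)) ⟩
    ((n ∸ 1) C 3 + ∣ B₁ ∩ B₂ ∣ C 3) ∸ (∣ B₁ ∣ C 3 + ∣ B₂ ∣ C 3) ∎
    where open ≤-Reasoning

∣p∩q∣≡m : ∀ {m} {p q : Subset (4 + m)} → ∣ p ∣ ≡ 1 + m → ∣ q ∣ ≡ 1 + m → ∣ ∁ (p ∪ q) ∣ ≡ 2 →
  ∣ p ∩ q ∣ ≡ m
∣p∩q∣≡m {m} {p} {q} ∣p∣≡ ∣q∣≡ ∣∁[p∪q]∣≡ = +-cancelˡ-≡ (2 + m) _ _ (begin
  (2 + m) + ∣ p ∩ q ∣         ≡⟨ cong (_+ ∣ p ∩ q ∣) ∣p∪q∣≡ ⟨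
  ∣ p ∪ q ∣ + ∣ p ∩ q ∣       ≡⟨ ∣p∪q∣+∣p∩q∣≡∣p∣+∣q∣ p q ⟩
  ∣ p ∣ + ∣ q ∣               ≡⟨ cong₂ _+_ ∣p∣≡ ∣q∣≡ ⟩
  (1 + m) + (1 + m)           ≡⟨ cong suc (+-suc m m) ⟩
  (2 + m) + m                 ∎)
  where
  open ≡-Reasoning
  ∣p∪q∣≡ : ∣ p ∪ q ∣ ≡ 2 + m
  ∣p∪q∣≡ = begin
    ∣ p ∪ q ∣                  ≡⟨ cong ∣_∣ (∁-involutive (p ∪ q)) ⟨
    ∣ ∁ (∁ (p ∪ q)) ∣          ≡⟨ ∣∁p∣≡n∸∣p∣ (∁ (p ∪ q)) ⟩
    (4 + m) ∸ ∣ ∁ (p ∪ q) ∣    ≡⟨ cong ((4 + m) ∸_) ∣∁[p∪q]∣≡ ⟩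
    2 + m                      ∎

lemma5p2 : ∀ (n : ℕ) → 7 ≤ n → (F : IndependentSet n) → (B₁ B₂ : Subset n) →
    B₁ ≢ B₂ → ∣ B₁ ∣ ≡ n ∸ 3 → ∣ B₂ ∣ ≡ n ∸ 3 →
    weightB F B₁ ≡ n ∸ 3 → weightB F B₂ ≡ n ∸ 3 →
    ((a : Fin n) → a ∉ B₁ →
      weightA F a ≤ ((n ∸ 1) C 3) ∸ ((n ∸ 3) C 3))
    × (∣ ∁ (B₁ ∪ B₂) ∣ ≡ 2 → (a : Fin n) → a ∉ B₁ → a ∉ B₂ →
      weightA F a ≤ (((n ∸ 1) C 3) + ((n ∸ 4) C 3)) ∸ (2 * ((n ∸ 3) C 3)))
lemma5p2 (suc (suc (suc (suc m)))) (s≤s (s≤s (s≤s (s≤s _)))) F B₁ B₂ _ ∣B₁∣≡ ∣B₂∣≡ w₁ w₂ =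
    (λ a a∉B₁ → subst (λ k → weightA F a ≤ (3 + m) C 3 ∸ k C 3) ∣B₁∣≡
                      (weightA-outside-saturated F 3≤n sat₁ a∉B₁))
  , (λ ∣∁[B₁∪B₂]∣≡2 a a∉B₁ a∉B₂ → begin
      weightA F a
        ≤⟨ weightA-outside-two-saturated F 3≤n sat₁ sat₂ a∉B₁ a∉B₂ ⟩
      ((3 + m) C 3 + ∣ B₁ ∩ B₂ ∣ C 3) ∸ (∣ B₁ ∣ C 3 + ∣ B₂ ∣ C 3)
        ≡⟨ cong₂ (λ k l → ((3 + m) C 3 + k C 3) ∸ l) (∣p∩q∣≡m {p = B₁} ∣B₁∣≡ ∣B₂∣≡ ∣∁[B₁∪B₂]∣≡2) twice ⟩
      ((3 + m) C 3 + m C 3) ∸ 2 * ((1 + m) C 3) ∎)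
  where
  open ≤-Reasoning
  3≤n : 3 ≤ 4 + m
  3≤n = s≤s (s≤s (s≤s z≤n))
  sat₁ : Saturated F B₁
  sat₁ = trans w₁ (sym ∣B₁∣≡)
  sat₂ : Saturated F B₂
  sat₂ = trans w₂ (sym ∣B₂∣≡)
  twice : ∣ B₁ ∣ C 3 + ∣ B₂ ∣ C 3 ≡ 2 * ((1 + m) C 3)
  twice = cong₂ (λ k l → k C 3 + l) ∣B₁∣≡ (trans (cong (_C 3) ∣B₂∣≡) (sym (+-identityʳ _)))
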